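{- For every finite $n\geq 2$ there exists an atomic algebra in $\mathrm{SA}_n$ that is not completely representable.
   Context: $\mathrm{SA}_n$ is the class of cylindrifier-free reducts of (quasi-)polyadic algebras of dimension $n$: Boolean algebras with unary substitution operations $s_\tau$ ($\tau\in{}^nn$, generated by the replacements $s^i_j$ and transpositions $p_{ij}$). The concrete algebras are fields of subsets of $V={}^nU$ with $S_\tau X=\{s\in V:s\circ\tau\in X\}$. An atomic $\mathfrak A\in\mathrm{SA}_n$ is completely representable if there are a set $U$ and an injective homomorphism $f:\mathfrak A\to\wp({}^nU)$ (preserving Boolean operations and all $s_\tau$) such that $\bigcup_{x\in\mathrm{At}\mathfrak A}f(x)={}^nU$, equivalently $f$ preserves all existing suprema. -}

module Defs where

open import Level using (0ℓ)
open import Data.Nat using (ℕ)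
open import Data.Fin using (Fin)
open import Data.Product using (Σ; ∃; _×_; _,_)
open import Data.Sum using (_⊎_)
open import Function using (id; _∘_; _⇔_)
open import Relation.Nullary using (¬_)
open import Algebra.Lattice.Bundles using (BooleanAlgebra)
import Data.Unit
import Data.Empty

Transf : ℕ → Set
Transf n = Fin n → Fin n

-- An abstract SA_n: a Boolean algebra with unary substitution operations s_τ
-- (τ ∈ ⁿn), each a Boolean endomorphism, forming a monoid action:
--   s_id x = x,   s_τ (s_σ x) = s_(τ∘σ) x
-- (matching the concrete S_τ S_σ X = S_(τ∘σ) X).
record SA (n : ℕ) : Set₁ where
  field
    BA : BooleanAlgebra 0ℓ 0ℓ
  open BooleanAlgebra BA public renaming (¬_ to ∁_; ⊤ to 1ᴮ; ⊥ to 0ᴮ)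
  field
    s       : Transf n → Carrier → Carrier
    s-cong  : ∀ τ {x y} → x ≈ y → s τ x ≈ s τ y
    s-∨     : ∀ τ x y → s τ (x ∨ y) ≈ (s τ x ∨ s τ y)
    s-∧     : ∀ τ x y → s τ (x ∧ y) ≈ (s τ x ∧ s τ y)
    s-¬     : ∀ τ x → s τ (∁ x) ≈ ∁ (s τ x)
    s-⊤     : ∀ τ → s τ 1ᴮ ≈ 1ᴮ
    s-⊥     : ∀ τ → s τ 0ᴮ ≈ 0ᴮ
    s-id    : ∀ x → s id x ≈ x
    s-comp  : ∀ τ σ x → s τ (s σ x) ≈ s (τ ∘ σ) x

module _ {n : ℕ} (𝔄 : SA n) where
  open SA 𝔄

  _≤ᴮ_ : Carrier → Carrier → Set
  x ≤ᴮ y = (x ∧ y) ≈ x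

  IsAtom : Carrier → Set
  IsAtom a = ¬ (a ≈ 0ᴮ) × (∀ b → b ≤ᴮ a → (b ≈ 0ᴮ) ⊎ (b ≈ a))

  Atomic : Set
  Atomic = ∀ x → ¬ (x ≈ 0ᴮ) → ∃ λ a → IsAtom a × a ≤ᴮ x

  Subset : Set → Set₁
  Subset U = (Fin n → U) → Set

  _≐_ : {U : Set} → Subset U → Subset U → Set
  X ≐ Y = ∀ v → X v ⇔ Y v

  record Representation (U : Set) : Set₁ where
    field
      f      : Carrier → Subset U
      f-cong : ∀ {x y} → x ≈ y → f x ≐ f y
      f-inj  : ∀ {x y} → f x ≐ f y → x ≈ y
      f-∨    : ∀ x y → f (x ∨ y) ≐ (λ v → f x v ⊎ f y v)
      f-∧    : ∀ x y → f (x ∧ y) ≐ (λ v → f x v × f y v)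
      f-¬    : ∀ x → f (∁ x) ≐ (λ v → ¬ f x v)
      f-⊤    : f 1ᴮ ≐ (λ v → Data.Unit.⊤)
      f-⊥    : f 0ᴮ ≐ (λ v → Data.Empty.⊥)
      f-s    : ∀ τ x → f (s τ x) ≐ (λ v → f x (v ∘ τ))

  CompletelyRepresentable : Set₁
  CompletelyRepresentable =
    Σ Set λ U → Σ (Representation U) λ r →
      ∀ (v : Fin n → U) → ∃ λ a → IsAtom a × Representation.f r a v

module Submission where

open import Defs
open import Level using (0ℓ)
open import Data.Nat using (ℕ; _≥_; _≤_; _<_; _⊔_; suc; s≤s; z≤n)
open import Data.Nat.Properties
  using (m⊔n≤o⇒m≤o; m⊔n≤o⇒n≤o; m≤m⊔n; m≤n⊔m; ≤-refl; ≤-total; n≤1+n; 1+n≰n; 1+n≢n; anyUpTo?)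
  renaming (_≟_ to _≟ℕ_)
open import Data.Bool using (Bool; true; false; not; _≟_) renaming (_∨_ to _∨ᵇ_; _∧_ to _∧ᵇ_)
open import Data.Bool.Properties using (∨-∧-isBooleanAlgebra; ∧-zeroʳ; ¬-not)
open import Data.Fin using (Fin; punchOut) renaming (zero to fzero; suc to fsuc)
open import Data.Fin.Properties using (all?; any?; punchOut-injective; injective⇒≤) renaming (_≟_ to _≟ᶠ_)
open import Data.Product using (Σ; ∃; _×_; _,_)
open import Data.Sum using (_⊎_; inj₁; inj₂)
open import Function using (id; _∘_; const; Equivalence)
open import Data.Empty using (⊥-elim)
open import Function.Definitions using (Injective; Surjective)
open import Relation.Nullary using (¬_; Dec; yes; no; contradiction; map′)
open import Relation.Nullary.Decidable using (⌊_⌋; _→-dec_)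
open import Relation.Binary.PropositionalEquality using (_≡_; _≢_; refl; sym; trans; cong; cong₂)
open import Algebra.Lattice.Bundles using (BooleanAlgebra)
open import Algebra.Lattice.Structures using (IsBooleanAlgebra)

-- On the finite–cofinite algebra of ℕ let s_τ be the identity for injective τ and,
-- for all other τ, the Boolean endomorphism sending finite sets to ∅ and cofinite
-- ones to ℕ. This is an atomic SA_n whose atoms are the singletons.
-- In a representation the constant map τ = (i ↦ 0) fixes every diagonal tuple
-- (u, …, u), so such a tuple lies in f(a) iff it lies in f(s_τ a). For an atom a
-- we have s_τ a = 0, hence no atom covers a diagonal tuple; a diagonal tuple
-- exists because the base of a representation of a nontrivial algebra is nonempty.

injective? : ∀ {n} (τ : Transf n) → Dec (Injective _≡_ _≡_ τ)
injective? τ = map′ (λ inj {i} {j} → inj i j) (λ inj i j → inj)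
  (all? λ i → all? λ j → (τ i ≟ᶠ τ j) →-dec (i ≟ᶠ j))

injective⇒surjective : ∀ {n} {τ : Transf n} → Injective _≡_ _≡_ τ → Surjective _≡_ _≡_ τ
injective⇒surjective {suc m} {τ} inj i with any? (λ j → τ j ≟ᶠ i)
... | yes (j , τj≡i) = j , λ { refl → τj≡i }
... | no  missed     = contradiction (injective⇒≤ punchOut∘τ-injective) 1+n≰n
  where
  avoid : ∀ j → i ≢ τ j
  avoid j i≡τj = missed (j , sym i≡τj)

  punchOut∘τ-injective : Injective _≡_ _≡_ (λ j → punchOut (avoid j))
  punchOut∘τ-injective {j} {k} = inj ∘ punchOut-injective (avoid j) (avoid k)

constant-nonInjective : ∀ {n} (i : Fin (suc (suc n))) → ¬ Injective _≡_ _≡_ (const {B = Fin (suc (suc n))} i)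
constant-nonInjective i inj = contradiction (inj {fzero} {fsuc fzero} refl) λ ()

∘-injectiveˡ : ∀ {n} {τ σ : Transf n} →
               Injective _≡_ _≡_ σ → Injective _≡_ _≡_ (τ ∘ σ) → Injective _≡_ _≡_ τ
∘-injectiveˡ {σ = σ} σ-inj τσ-inj {i} {j} τi≡τj
  with i′ , σi′≡i ← injective⇒surjective σ-inj i
     | j′ , σj′≡j ← injective⇒surjective σ-inj j
  with refl ← σi′≡i refl | refl ← σj′≡j refl = cong σ (τσ-inj τi≡τj)

record IdempotentEndomorphism (B : BooleanAlgebra 0ℓ 0ℓ) : Set where
  open BooleanAlgebra B using (Carrier; _≈_; _∨_; _∧_) renaming (¬_ to ∁_; ⊤ to 1ᴮ; ⊥ to 0ᴮ)
  field
    h      : Carrier → Carrier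
    h-cong : ∀ {x y} → x ≈ y → h x ≈ h y
    h-∨    : ∀ x y → h (x ∨ y) ≈ (h x ∨ h y)
    h-∧    : ∀ x y → h (x ∧ y) ≈ (h x ∧ h y)
    h-¬    : ∀ x → h (∁ x) ≈ ∁ (h x)
    h-⊤    : h 1ᴮ ≈ 1ᴮ
    h-⊥    : h 0ᴮ ≈ 0ᴮ
    h-idem : ∀ x → h (h x) ≈ h x

module CollapseOffInjective {B : BooleanAlgebra 0ℓ 0ℓ} (e : IdempotentEndomorphism B) (n : ℕ) where
  open BooleanAlgebra B using (Carrier; _≈_; _∨_; _∧_) renaming (¬_ to ∁_; ⊤ to 1ᴮ; ⊥ to 0ᴮ; refl to ≈-refl)
  open IdempotentEndomorphism e

  act : {P : Set} → Dec P → Carrier → Carrier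
  act (yes _) = id
  act (no _)  = h

  substitution : Transf n → Carrier → Carrier
  substitution τ = act (injective? τ)

  private
    variable
      P : Set

    act-cong : (d : Dec P) → ∀ {x y} → x ≈ y → act d x ≈ act d y
    act-cong (yes _) x≈y = x≈y
    act-cong (no _)  x≈y = h-cong x≈y

    act-∨ : (d : Dec P) → ∀ x y → act d (x ∨ y) ≈ (act d x ∨ act d y)
    act-∨ (yes _) x y = ≈-refl
    act-∨ (no _)      = h-∨

    act-∧ : (d : Dec P) → ∀ x y → act d (x ∧ y) ≈ (act d x ∧ act d y)
    act-∧ (yes _) x y = ≈-refl
    act-∧ (no _)      = h-∧

    act-¬ : (d : Dec P) → ∀ x → act d (∁ x) ≈ ∁ (act d x)
    act-¬ (yes _) x = ≈-refl
    act-¬ (no _)    = h-¬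

    act-⊤ : (d : Dec P) → act d 1ᴮ ≈ 1ᴮ
    act-⊤ (yes _) = ≈-refl
    act-⊤ (no _)  = h-⊤

    act-⊥ : (d : Dec P) → act d 0ᴮ ≈ 0ᴮ
    act-⊥ (yes _) = ≈-refl
    act-⊥ (no _)  = h-⊥

  -- τ ∘ σ is injective iff τ and σ are; for τ this needs that injective self-maps of Fin n are onto.
  substitution-∘ : ∀ τ σ x → substitution τ (substitution σ x) ≈ substitution (τ ∘ σ) x
  substitution-∘ τ σ x with injective? τ | injective? σ | injective? (τ ∘ σ)
  ... | yes τ-inj | yes σ-inj | yes _      = ≈-refl
  ... | yes τ-inj | yes σ-inj | no ¬τσ-inj = contradiction (λ {_ _} → σ-inj ∘ τ-inj) ¬τσ-inj
  ... | _         | no ¬σ-inj | yes τσ-inj = contradiction (λ {_ _} → τσ-inj ∘ cong τ) ¬σ-inj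
  ... | yes _     | no _      | no _       = ≈-refl
  ... | no ¬τ-inj | yes σ-inj | yes τσ-inj = contradiction (λ {_ _} → ∘-injectiveˡ σ-inj τσ-inj) ¬τ-inj
  ... | no _      | yes _     | no _       = ≈-refl
  ... | no _      | no _      | no _       = h-idem x

  substitution-id : ∀ x → substitution id x ≈ x
  substitution-id x with injective? (id {A = Fin n})
  ... | yes _    = ≈-refl
  ... | no ¬inj = contradiction (λ {_ _} → id) ¬inj

  substitution-nonInjective : ∀ {τ} → ¬ Injective _≡_ _≡_ τ → ∀ x → substitution τ x ≈ h x
  substitution-nonInjective {τ} ¬inj x with injective? τ
  ... | yes inj = contradiction (λ {_ _} → inj) ¬inj
  ... | no _    = ≈-refl

  sa : SA n
  sa = record
    { BA     = B
    ; s      = substitution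
    ; s-cong = act-cong ∘ injective?
    ; s-∨    = act-∨ ∘ injective?
    ; s-∧    = act-∧ ∘ injective?
    ; s-¬    = act-¬ ∘ injective?
    ; s-⊤    = act-⊤ ∘ injective?
    ; s-⊥    = act-⊥ ∘ injective?
    ; s-id   = substitution-id
    ; s-comp = substitution-∘
    }

module _ {n : ℕ} (𝔄 : SA n) where
  open SA 𝔄
  open Representation

  representation-base-nonempty : ∀ {U} → Fin n → Representation 𝔄 U → ¬ (1ᴮ ≈ 0ᴮ) → ¬ ¬ U
  representation-base-nonempty i r 1≉0 ¬U = 1≉0 (f-inj r λ v → ⊥-elim (¬U (v i)))

  diagonal-not-in-atom : ∀ {U} (r : Representation 𝔄 U) (i : Fin n) →
                         (∀ a → IsAtom 𝔄 a → (a ∧ s (const i) a) ≈ 0ᴮ) →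
                         ∀ (u : U) a → IsAtom 𝔄 a → ¬ f r a (const u)
  diagonal-not-in-atom r i atom∧s≈0 u a atom u∈a =
    to (f-⊥ r (const u)) (to (f-cong r (atom∧s≈0 a atom) (const u)) u∈a∧s)
    where
    open Equivalence
    u∈a∧s : f r (a ∧ s (const i) a) (const u)
    u∈a∧s = from (f-∧ r a _ (const u)) (u∈a , from (f-s r (const i) a (const u)) u∈a)

  ¬completelyRepresentable : (i : Fin n) → ¬ (1ᴮ ≈ 0ᴮ) →
                             (∀ a → IsAtom 𝔄 a → (a ∧ s (const i) a) ≈ 0ᴮ) →
                             ¬ CompletelyRepresentable 𝔄
  ¬completelyRepresentable i 1≉0 atom∧s≈0 (U , r , atoms-cover) =
    representation-base-nonempty i r 1≉0 λ u →
      let a , atom , u∈a = atoms-cover (const u)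
      in  diagonal-not-in-atom r i atom∧s≈0 u a atom u∈a

-- A finite (limit = false) or cofinite (limit = true) subset of ℕ.
record FinCofin : Set where
  constructor finCofin
  field
    member   : ℕ → Bool
    limit    : Bool
    bound    : ℕ
    eventual : ∀ {m} → bound ≤ m → member m ≡ limit
open FinCofin

infix 4 _≈_
_≈_ : FinCofin → FinCofin → Set
x ≈ y = ∀ m → member x m ≡ member y m

private
  pointwise₂ : (Bool → Bool → Bool) → FinCofin → FinCofin → FinCofin
  pointwise₂ _•_ x y = finCofin (λ m → member x m • member y m) (limit x • limit y) (bound x ⊔ bound y)
    λ bx⊔by≤m → cong₂ _•_ (eventual x (m⊔n≤o⇒m≤o _ _ bx⊔by≤m)) (eventual y (m⊔n≤o⇒n≤o _ _ bx⊔by≤m))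

_∪_ _∩_ : FinCofin → FinCofin → FinCofin
_∪_ = pointwise₂ _∨ᵇ_
_∩_ = pointwise₂ _∧ᵇ_

∁_ : FinCofin → FinCofin
∁ x = finCofin (not ∘ member x) (not (limit x)) (bound x) (cong not ∘ eventual x)

∅ ℕ-all : FinCofin
∅     = finCofin (const false) false 0 (const refl)
ℕ-all = finCofin (const true)  true  0 (const refl)

isBooleanAlgebra : IsBooleanAlgebra _≈_ _∪_ _∩_ ∁_ ℕ-all ∅
isBooleanAlgebra = record
  { isDistributiveLattice = record
    { isLattice = record
      { isEquivalence = record
        { refl  = λ _ → refl
        ; sym   = λ x≈y m → sym (x≈y m)
        ; trans = λ x≈y y≈z m → trans (x≈y m) (y≈z m)
        }
      ; ∨-comm     = λ x y m → 𝔹.∨-comm (member x m) (member y m)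
      ; ∨-assoc    = λ x y z m → 𝔹.∨-assoc (member x m) (member y m) (member z m)
      ; ∨-cong     = λ x≈y u≈v m → cong₂ _∨ᵇ_ (x≈y m) (u≈v m)
      ; ∧-comm     = λ x y m → 𝔹.∧-comm (member x m) (member y m)
      ; ∧-assoc    = λ x y z m → 𝔹.∧-assoc (member x m) (member y m) (member z m)
      ; ∧-cong     = λ x≈y u≈v m → cong₂ _∧ᵇ_ (x≈y m) (u≈v m)
      ; absorptive = (λ x y m → 𝔹.∨-absorbs-∧ (member x m) (member y m))
                   , (λ x y m → 𝔹.∧-absorbs-∨ (member x m) (member y m))
      }
    ; ∨-distrib-∧ = (λ x y z m → 𝔹.∨-distribˡ-∧ (member x m) (member y m) (member z m))
                  , (λ x y z m → 𝔹.∨-distribʳ-∧ (member x m) (member y m) (member z m))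
    ; ∧-distrib-∨ = (λ x y z m → 𝔹.∧-distribˡ-∨ (member x m) (member y m) (member z m))
                  , (λ x y z m → 𝔹.∧-distribʳ-∨ (member x m) (member y m) (member z m))
    }
  ; ∨-complement = (λ x m → 𝔹.∨-complementˡ (member x m)) , (λ x m → 𝔹.∨-complementʳ (member x m))
  ; ∧-complement = (λ x m → 𝔹.∧-complementˡ (member x m)) , (λ x m → 𝔹.∧-complementʳ (member x m))
  ; ¬-cong       = λ x≈y m → cong not (x≈y m)
  }
  where module 𝔹 = IsBooleanAlgebra ∨-∧-isBooleanAlgebra

finCofinAlgebra : BooleanAlgebra 0ℓ 0ℓ
finCofinAlgebra = record
  { Carrier = FinCofin ; _≈_ = _≈_ ; _∨_ = _∪_ ; _∧_ = _∩_ ; ¬_ = ∁_ ; ⊤ = ℕ-all ; ⊥ = ∅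
  ; isBooleanAlgebra = isBooleanAlgebra
  }

limit-cong : ∀ {x y} → x ≈ y → limit x ≡ limit y
limit-cong {x} {y} x≈y =
  trans (sym (eventual x (m≤m⊔n (bound x) (bound y))))
    (trans (x≈y _) (eventual y (m≤n⊔m (bound x) (bound y))))

collapse : FinCofin → FinCofin
collapse x = finCofin (const (limit x)) (limit x) 0 (const refl)

collapse-endomorphism : IdempotentEndomorphism finCofinAlgebra
collapse-endomorphism = record
  { h      = collapse
  ; h-cong = λ {x} {y} x≈y _ → limit-cong {x} {y} x≈y
  ; h-∨    = λ _ _ _ → refl
  ; h-∧    = λ _ _ _ → refl
  ; h-¬    = λ _ _ → refl
  ; h-⊤    = λ _ → refl
  ; h-⊥    = λ _ → refl
  ; h-idem = λ _ _ → refl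
  }

finCofinSA : (n : ℕ) → SA n
finCofinSA = CollapseOffInjective.sa collapse-endomorphism

｛_｝ : ℕ → FinCofin
｛ k ｝ = finCofin (λ m → ⌊ m ≟ℕ k ⌋) false (suc k) k<m⇒m≢k
  where
  k<m⇒m≢k : ∀ {m} → suc k ≤ m → ⌊ m ≟ℕ k ⌋ ≡ false
  k<m⇒m≢k {m} k<m with m ≟ℕ k
  ... | yes refl = contradiction k<m 1+n≰n
  ... | no  _    = refl

∈｛｝ : ∀ k → member ｛ k ｝ k ≡ true
∈｛｝ k with k ≟ℕ k
... | yes _   = refl
... | no  k≢k = contradiction refl k≢k

∉｛｝ : ∀ {k m} → m ≢ k → member ｛ k ｝ m ≡ false
∉｛｝ {k} {m} m≢k with m ≟ℕ k
... | yes m≡k = contradiction m≡k m≢k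
... | no  _   = refl

｛｝≉∅ : ∀ k → ¬ (｛ k ｝ ≈ ∅)
｛｝≉∅ k ｛k｝≈∅ = contradiction (trans (sym (∈｛｝ k)) (｛k｝≈∅ k)) λ ()

｛｝⊆ : ∀ x {k} → member x k ≡ true → (｛ k ｝ ∩ x) ≈ ｛ k ｝
｛｝⊆ x {k} k∈x m with m ≟ℕ k
... | yes refl = k∈x
... | no  _    = refl

nonempty-has-member : ∀ x → ¬ (x ≈ ∅) → ∃ λ k → member x k ≡ true
nonempty-has-member x x≉∅ with anyUpTo? (λ m → member x m ≟ true) (suc (bound x))
... | yes (k , _ , k∈x) = k , k∈x
... | no  none          = contradiction x≈∅ x≉∅
  where
  absent : ∀ {m} → m < suc (bound x) → member x m ≡ false
  absent {m} m≤b = ¬-not λ m∈x → none (m , m≤b , m∈x)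

  x≈∅ : x ≈ ∅
  x≈∅ m with ≤-total m (bound x)
  ... | inj₁ m≤b = absent (s≤s m≤b)
  ... | inj₂ b≤m = trans (eventual x b≤m) (trans (sym (eventual x ≤-refl)) (absent ≤-refl))

module _ (n : ℕ) where
  open CollapseOffInjective collapse-endomorphism n using (substitution; substitution-nonInjective)

  ｛｝-isAtom : ∀ k → IsAtom (finCofinSA n) ｛ k ｝
  ｛｝-isAtom k = ｛｝≉∅ k , below-｛k｝
    where
    equal-if-agree-at-k : ∀ b y → (b ∩ ｛ k ｝) ≈ b → (∀ {m} → m ≢ k → member y m ≡ false) →
                          member b k ≡ member y k → b ≈ y
    equal-if-agree-at-k b y b⊆｛k｝ y-off-k b≡y-at-k m with m ≟ℕ k
    ... | yes refl = b≡y-at-k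
    ... | no  m≢k  =
      trans (sym (b⊆｛k｝ m)) (trans (cong (member b m ∧ᵇ_) (∉｛｝ m≢k)) (trans (∧-zeroʳ _) (sym (y-off-k m≢k))))

    below-｛k｝ : ∀ b → (b ∩ ｛ k ｝) ≈ b → (b ≈ ∅) ⊎ (b ≈ ｛ k ｝)
    below-｛k｝ b b⊆｛k｝ with member b k in k∈b?
    ... | false = inj₁ (equal-if-agree-at-k b ∅ b⊆｛k｝ (const refl) k∈b?)
    ... | true  = inj₂ (equal-if-agree-at-k b ｛ k ｝ b⊆｛k｝ ∉｛｝ (trans k∈b? (sym (∈｛｝ k))))

  atomic : Atomic (finCofinSA n)
  atomic x x≉∅ =
    let k , k∈x = nonempty-has-member x x≉∅
    in  ｛ k ｝ , ｛｝-isAtom k , ｛｝⊆ x k∈x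

  -- A cofinite a properly contains ｛ bound a ｝, as bound a + 1 ∈ a as well.
  atom-finite : ∀ a → IsAtom (finCofinSA n) a → limit a ≡ false
  atom-finite a (_ , atom) with limit a in lim
  ... | false = refl
  ... | true with atom ｛ bound a ｝ (｛｝⊆ a (trans (eventual a ≤-refl) lim))
  ...   | inj₁ ｛b｝≈∅ = contradiction ｛b｝≈∅ (｛｝≉∅ (bound a))
  ...   | inj₂ ｛b｝≈a = contradiction
            (trans (sym (∉｛｝ 1+n≢n)) (trans (｛b｝≈a _) (trans (eventual a (n≤1+n _)) lim))) λ ()

  atom∩nonInjective≈∅ : ∀ {τ} a → ¬ Injective _≡_ _≡_ τ → IsAtom (finCofinSA n) a →
                        (a ∩ substitution τ a) ≈ ∅
  atom∩nonInjective≈∅ a ¬inj atom m =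
    trans (cong (member a m ∧ᵇ_) (trans (substitution-nonInjective ¬inj a m) (atom-finite a atom))) (∧-zeroʳ _)

mainTheorem6 : (n : ℕ) → n ≥ 2 →
    Σ (SA n) λ 𝔄 → Atomic 𝔄 × ¬ CompletelyRepresentable 𝔄
mainTheorem6 n@(suc (suc _)) (s≤s (s≤s z≤n)) =
  finCofinSA n , atomic n ,
  ¬completelyRepresentable (finCofinSA n) fzero (λ ℕ≈∅ → contradiction (ℕ≈∅ 0) λ ())
    (λ a → atom∩nonInjective≈∅ n a (constant-nonInjective fzero))
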